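{- Let $n$ be a positive integer and consider a partition of $n$ in which the nonzero multiplicities of the distinct parts are pairwise different. Then the number $r$ of distinct multiplicities (equivalently, of distinct parts) in this partition satisfies $r\le (6n)^{1/3}$.
   Context: A partition of $n$ can be written as $n=m_1p_1+\cdots+m_rp_r$ where $p_1<\cdots<p_r$ are the distinct parts and $m_i\ge1$ is the multiplicity of $p_i$; the partitions considered are those with $m_1,\dots,m_r$ pairwise distinct. -}

module Defs where

open import Data.Nat using (ℕ; _+_; _*_; _<_; _≤_)
open import Data.Product using (_×_; _,_; proj₁; proj₂)
open import Data.List using (List; map; length)
open import Data.Nat.ListAction using (sum)
open import Data.List.Relation.Unary.All using (All)
open import Data.List.Relation.Unary.AllPairs using (AllPairs)
open import Data.List.Relation.Unary.Unique.Propositional using (Unique)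
open import Relation.Binary.PropositionalEquality using (_≡_)

-- A partition of n in multiplicity notation: a list of pairs (p , m)
-- meaning the part p occurs with multiplicity m.
record PartitionMult (n : ℕ) : Set where
  constructor mkPartitionMult
  field
    pairs       : List (ℕ × ℕ)
    partsPos    : All (λ pm → 1 ≤ proj₁ pm) pairs
    multsPos    : All (λ pm → 1 ≤ proj₂ pm) pairs
    partsIncr   : AllPairs (λ a b → proj₁ a < proj₁ b) pairs
    sumEq       : sum (map (λ pm → proj₂ pm * proj₁ pm) pairs) ≡ n

  numParts : ℕ
  numParts = length pairs

  multiplicities : List ℕ
  multiplicities = map proj₂ pairs

open PartitionMult public

DistinctMultiplicities : ∀ {n} → PartitionMult n → Set
DistinctMultiplicities λ' = Unique (multiplicities λ')

module Submission where

-- Write the partition as n = m₁p₁ + ⋯ + m_r p_r with 1 ≤ p₁ < ⋯ < p_r and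
-- pairwise distinct multiplicities mᵢ ≥ 1.  Since p_i ≥ i, Abel summation
-- gives  n ≥ Σᵢ i·mᵢ = Σⱼ Sⱼ  where Sⱼ = mⱼ + ⋯ + m_r is a sum of r-j+1
-- distinct positive integers, hence 2Sⱼ ≥ (r-j+1)(r-j+2).  Summing over j,
-- 6n ≥ Σ_{k ≤ r} 3k(k+1) = r(r+1)(r+2) ≥ r³.

open import Defs
open import Data.Nat using (ℕ; suc; s≤s; _+_; _*_; _^_; _≤_; _<_)
open import Data.Nat.Properties
open import Data.Nat.ListAction using (sum)
open import Data.Nat.ListAction.Properties using (sum-↭)
open import Data.Nat.Tactic.RingSolver using (solve-∀)
open import Data.Product using (_×_; _,_; proj₁; proj₂; uncurry)
open import Data.List using (List; []; _∷_; map; length)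
open import Data.List.Properties using (length-map)
open import Data.List.Relation.Unary.All using (All; []; _∷_)
open import Data.List.Relation.Unary.All.Properties using (map⁺)
open import Data.List.Relation.Unary.AllPairs as AllPairs using (AllPairs; []; _∷_)
open import Data.List.Relation.Unary.Linked.Properties using (Linked⇒AllPairs)
open import Data.List.Relation.Unary.Unique.Propositional using (Unique)
open import Data.List.Relation.Binary.Permutation.Propositional using (_↭_; ↭-sym; ↭⇒↭ₛ)
open import Data.List.Relation.Binary.Permutation.Propositional.Properties using (All-resp-↭; ↭-length)
open import Data.List.Relation.Binary.Permutation.Setoid.Properties using (Unique-resp-↭)
open import Data.List.Sort ≤-decTotalOrder using (sort; sort-↭; sort-↗)
open import Relation.Binary.PropositionalEquality using (_≡_; sym; trans; cong; subst; subst₂; setoid)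

-- A strictly increasing list of k numbers, all greater than a, has sum at
-- least a·k + k(k+1)/2; the offset a is what makes the induction go through.
increasing-sum-bound : ∀ a (xs : List ℕ) → All (a <_) xs → AllPairs _<_ xs →
  length xs * suc (length xs) + 2 * a * length xs ≤ 2 * sum xs
increasing-sum-bound a [] [] [] = ≤-reflexive (*-zeroʳ (2 * a))
increasing-sum-bound a (x ∷ xs) (a<x ∷ _) (x<xs ∷ increasing) = begin
  suc k * suc (suc k) + 2 * a * suc k
    ≡⟨ regroup k a ⟩
  (k * suc k + 2 * suc a * k) + 2 * suc a
    ≤⟨ +-mono-≤ (increasing-sum-bound (suc a) xs (raise x<xs) increasing) (*-monoʳ-≤ 2 a<x) ⟩
  2 * sum xs + 2 * x
    ≡⟨ sym (trans (*-distribˡ-+ 2 x (sum xs)) (+-comm (2 * x) (2 * sum xs))) ⟩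
  2 * (x + sum xs) ∎
  where
  open ≤-Reasoning
  k : ℕ
  k = length xs
  regroup : ∀ k a → suc k * suc (suc k) + 2 * a * suc k
                  ≡ (k * suc k + 2 * suc a * k) + 2 * suc a
  regroup = solve-∀
  raise : ∀ {ys} → All (x <_) ys → All (suc a <_) ys
  raise [] = []
  raise (x<y ∷ x<ys) = <-≤-trans (s≤s a<x) x<y ∷ raise x<ys

distinct-sum-bound : (xs : List ℕ) → All (1 ≤_) xs → Unique xs →
  length xs * suc (length xs) ≤ 2 * sum xs
distinct-sum-bound xs positive distinct =
  subst₂ (λ l s → l * suc l ≤ 2 * s) (↭-length sorted↭xs) (sum-↭ sorted↭xs)
    (≤-trans (m≤m+n _ _)
      (increasing-sum-bound 0 (sort xs) (All-resp-↭ (↭-sym sorted↭xs) positive) increasing))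
  where
  sorted↭xs : sort xs ↭ xs
  sorted↭xs = sort-↭ xs
  increasing : AllPairs _<_ (sort xs)
  increasing = AllPairs.zipWith (uncurry ≤∧≢⇒<)
    ( Linked⇒AllPairs ≤-trans (sort-↗ xs)
    , Unique-resp-↭ (setoid ℕ) (↭⇒↭ₛ (↭-sym sorted↭xs)) distinct )

weight : List (ℕ × ℕ) → ℕ
weight pms = sum (map (λ pm → proj₂ pm * proj₁ pm) pms)

tetrahedral6 : ℕ → ℕ
tetrahedral6 k = k * suc k * suc (suc k)

weighted-bound : ∀ c (pms : List (ℕ × ℕ)) →
  All (λ pm → c < proj₁ pm) pms → AllPairs (λ a b → proj₁ a < proj₁ b) pms →
  All (λ pm → 1 ≤ proj₂ pm) pms → Unique (map proj₂ pms) →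
  6 * c * sum (map proj₂ pms) + tetrahedral6 (length pms) ≤ 6 * weight pms
weighted-bound c [] [] [] [] [] = ≤-reflexive (trans (+-identityʳ _) (*-zeroʳ (6 * c)))
weighted-bound c ((p , m) ∷ pms) (c<p ∷ _) (p<ps ∷ increasing) (m≥1 ∷ ms≥1) distinct@(_ ∷ distinct′) =
  begin
  6 * c * (m + S) + tetrahedral6 (suc k)
    ≡⟨ tetrahedral6-step c (m + S) k ⟩
  6 * c * (m + S) + (tetrahedral6 k + 3 * (suc k * suc (suc k)))
    ≤⟨ +-monoʳ-≤ (6 * c * (m + S)) (+-monoʳ-≤ (tetrahedral6 k) (*-monoʳ-≤ 3 tail-sums)) ⟩
  6 * c * (m + S) + (tetrahedral6 k + 3 * (2 * (m + S)))
    ≡⟨ regroup c m S k ⟩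
  6 * (m * suc c) + (6 * suc c * S + tetrahedral6 k)
    ≤⟨ +-mono-≤ (*-monoʳ-≤ 6 (*-monoʳ-≤ m c<p))
                (weighted-bound (suc c) pms (raise p<ps) increasing ms≥1 distinct′) ⟩
  6 * (m * p) + 6 * weight pms
    ≡⟨ sym (*-distribˡ-+ 6 (m * p) (weight pms)) ⟩
  6 * weight ((p , m) ∷ pms) ∎
  where
  open ≤-Reasoning
  k S : ℕ
  k = length pms
  S = sum (map proj₂ pms)
  tail-sums : suc k * suc (suc k) ≤ 2 * (m + S)
  tail-sums = subst (λ l → l * suc l ≤ 2 * (m + S)) (cong suc (length-map proj₂ pms))
    (distinct-sum-bound (m ∷ map proj₂ pms) (map⁺ {xs = (p , m) ∷ pms} (m≥1 ∷ ms≥1)) distinct)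
  tetrahedral6-step : ∀ c s k → 6 * c * s + suc k * suc (suc k) * suc (suc (suc k))
                    ≡ 6 * c * s + (k * suc k * suc (suc k) + 3 * (suc k * suc (suc k)))
  tetrahedral6-step = solve-∀
  regroup : ∀ c m s k → 6 * c * (m + s) + (k * suc k * suc (suc k) + 3 * (2 * (m + s)))
          ≡ 6 * (m * suc c) + (6 * suc c * s + k * suc k * suc (suc k))
  regroup = solve-∀
  raise : ∀ {qs : List (ℕ × ℕ)} → All (λ q → p < proj₁ q) qs → All (λ q → suc c < proj₁ q) qs
  raise [] = []
  raise (p<q ∷ p<qs) = <-≤-trans (s≤s c<p) p<q ∷ raise p<qs

cube≤tetrahedral6 : ∀ r → r ^ 3 ≤ tetrahedral6 r
cube≤tetrahedral6 r = begin
  r ^ 3                  ≡⟨ cube r ⟩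
  r * r * r              ≤⟨ *-mono-≤ (*-monoʳ-≤ r (n≤1+n r)) (≤-trans (n≤1+n r) (n≤1+n (suc r))) ⟩
  tetrahedral6 r ∎
  where
  open ≤-Reasoning
  -- x ^ 3 unfolds definitionally to x * (x * (x * 1))
  cube : ∀ x → x * (x * (x * 1)) ≡ x * x * x
  cube = solve-∀

lemma1 : (n : ℕ) → 1 ≤ n → (λ' : PartitionMult n) → DistinctMultiplicities λ' →
    numParts λ' ^ 3 ≤ 6 * n
lemma1 n _ (mkPartitionMult pms partsPos multsPos partsIncr sumEq) distinct = begin
  length pms ^ 3
    ≤⟨ cube≤tetrahedral6 (length pms) ⟩
  tetrahedral6 (length pms)
    ≤⟨ m≤n+m _ _ ⟩
  6 * 0 * sum (map proj₂ pms) + tetrahedral6 (length pms)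
    ≤⟨ weighted-bound 0 pms partsPos partsIncr multsPos distinct ⟩
  6 * weight pms
    ≡⟨ cong (6 *_) sumEq ⟩
  6 * n ∎
  where open ≤-Reasoning
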